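{- Suppose that $\mathcal{H}$ is a $\{K_4^{3- }, F_5\}$-free $3$-graph and $S \subseteq V(\mathcal{H})$. Then for every $v \in V(\mathcal{H})$, $$|L_{\mathcal{H}}(v, S)| \ge |L_{\mathcal{H}}(v)| - \alpha(\mathcal{H}) \cdot |V(\mathcal{H}) \setminus S|.$$
   Context: A $3$-graph is a collection $\mathcal{H}$ of $3$-element subsets (edges) of a finite vertex set $V(\mathcal{H})$. $K_4^{3- }$ is the $3$-graph with edges $\{abc,abd,acd\}$ and $F_5$ the $3$-graph with edges $\{abc,abd,cde\}$; $\{K_4^{3- },F_5\}$-free means containing no copy of either. The link $L_{\mathcal{H}}(v)$ is the graph consisting of all pairs $e$ with $e \cup \{v\} \in \mathcal{H}$, and $L_{\mathcal{H}}(v,S)$ is the set of edges of $L_{\mathcal{H}}(v)$ contained in $S$. A set $I$ is independent in $\mathcal{H}$ if every edge contains at most one vertex of $I$; $\alpha(\mathcal{H})$ is the maximum size of an independent set. -}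

module Defs where

open import Data.Nat using (ℕ; _+_; _*_; _≤_; _<_)
open import Data.Bool using (Bool; true; false; T; _∧_)
open import Data.Fin using (Fin; toℕ)
open import Data.Fin.Subset using (Subset; _∈_; ∣_∣; ∁)
open import Data.Fin.Subset.Properties using (_∈?_)
open import Data.List using (List; []; _∷_; length; filter; allFin; concatMap; map)
open import Data.List.Relation.Unary.Unique.Propositional using (Unique)
open import Data.Product using (_×_; _,_; Σ; proj₁; proj₂)
open import Relation.Binary.PropositionalEquality using (_≡_; _≢_)
open import Relation.Nullary using (¬_; Dec; yes; no)
open import Relation.Nullary.Decidable using (_×-dec_)
import Data.Nat.Properties as ℕP
import Data.Bool.Properties as BP

-- The edge set is {{a,b,c} | E a b c ≡ true}.
record ThreeGraph (n : ℕ) : Set where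
  field
    E        : Fin n → Fin n → Fin n → Bool
    sym₁₂    : ∀ a b c → E a b c ≡ E b a c
    sym₂₃    : ∀ a b c → E a b c ≡ E a c b
    distinct : ∀ a b c → E a b c ≡ true → a ≢ b × b ≢ c × a ≢ c
open ThreeGraph public

Edge : ∀ {n} → ThreeGraph n → Fin n → Fin n → Fin n → Set
Edge H a b c = E H a b c ≡ true

K4⁻-free : ∀ {n} → ThreeGraph n → Set
K4⁻-free {n} H = ∀ (a b c d : Fin n) → Unique (a ∷ b ∷ c ∷ d ∷ []) →
  ¬ (Edge H a b c × Edge H a b d × Edge H a c d)

F5-free : ∀ {n} → ThreeGraph n → Set
F5-free {n} H = ∀ (a b c d e : Fin n) → Unique (a ∷ b ∷ c ∷ d ∷ e ∷ []) →
  ¬ (Edge H a b c × Edge H a b d × Edge H c d e)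

-- unordered pairs {x,y} of vertices, listed once each as (x , y) with x < y
pairs : (n : ℕ) → List (Fin n × Fin n)
pairs n = filter (λ p → toℕ (proj₁ p) ℕP.<? toℕ (proj₂ p))
                 (concatMap (λ x → map (λ y → (x , y)) (allFin n)) (allFin n))

linkIn : ∀ {n} → ThreeGraph n → Fin n → Subset n → ℕ
linkIn H v S = length (filter (λ p → (proj₁ p ∈? S) ×-dec ((proj₂ p ∈? S) ×-dec
                                      (E H v (proj₁ p) (proj₂ p) BP.≟ true)))
                              (pairs _))

linkSize : ∀ {n} → ThreeGraph n → Fin n → ℕ
linkSize H v = length (filter (λ p → E H v (proj₁ p) (proj₂ p) BP.≟ true) (pairs _))

Independent : ∀ {n} → ThreeGraph n → Subset n → Set
Independent {n} H I = ∀ (a b c : Fin n) → Edge H a b c →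
  ¬ (a ∈ I × b ∈ I) × ¬ (a ∈ I × c ∈ I) × ¬ (b ∈ I × c ∈ I)

IsIndependenceNumber : ∀ {n} → ThreeGraph n → ℕ → Set
IsIndependenceNumber {n} H α =
  Σ (Subset n) (λ I → Independent H I × ∣ I ∣ ≡ α) ×
  (∀ (I : Subset n) → Independent H I → ∣ I ∣ ≤ α)

{-# OPTIONS --safe #-}
-- Two vertices x, y joined to u in the link of v span no edge xyz of H:
-- for z ∈ {u, v} the edges vux, vuy, xyz would form a K₄³⁻, otherwise an F₅.
-- So the link neighbourhood of u is independent and every vertex has link degree at most α.
-- A link edge not inside S has an endpoint outside S, hence at most α · |V ∖ S| of them.
module Submission where

open import Defs
open import Data.Nat using (ℕ; zero; suc; _+_; _*_; _≤_; _<_; z≤n; s≤s)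
open import Data.Fin using (Fin; toℕ; zero; suc) renaming (_≟_ to _≟ᶠ_)
open import Data.Fin.Subset using (Subset; ∣_∣; ∁; _∈_)

open import Level using (Level)
open import Data.Nat.Properties
  using (+-*-semiring; +-identityʳ; ≤-trans; ≤-reflexive; +-mono-≤; +-monoʳ-≤; *-monoʳ-≤; *-comm; *-distribˡ-+;
         module ≤-Reasoning)
open import Data.Fin.Properties using (_<?_; <-asym)
open import Data.Fin.Subset.Properties using (_∈?_)
open import Data.Bool using (Bool; true; false; if_then_else_)
import Data.Bool.Properties as Bool
open import Data.List using (List; []; _∷_; _++_; length; filter; map; concatMap; tabulate)
open import Data.List.Properties using (length-++; filter-++; map-tabulate)
open import Data.List.Relation.Unary.All using (_∷_; [])
open import Data.List.Relation.Unary.AllPairs using (_∷_; [])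
import Data.Vec as Vec
import Data.Vec.Properties as Vec
open import Data.Product using (_×_; _,_; proj₁; proj₂; uncurry)
open import Function using (id; _∘_; _⇔_; mk⇔)
open import Relation.Nullary using (¬_; Dec; yes; no; does; ¬?; contradiction)
open import Relation.Nullary.Decidable using (_×-dec_; does-⇔)
open import Relation.Unary as U using (Pred)
open import Relation.Unary.Properties using (_∩?_)
open import Relation.Binary using (Rel; Symmetric; Decidable)
open import Relation.Binary.PropositionalEquality
open import Algebra.Properties.Semiring.Sum +-*-semiring
  using (sum; sum-syntax; ∑-distrib-+; ∑-comm; sum-cong-≗; *-distribˡ-sum; *-distribʳ-sum)

private
  variable
    a p q r s : Level
    A : Set a
    n : ℕ

𝟙 : {P : Set p} → Dec P → ℕ
𝟙 d = if does d then 1 else 0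

𝟙-⇔ : {P : Set p} {Q : Set q} → P ⇔ Q → (P? : Dec P) (Q? : Dec Q) → 𝟙 P? ≡ 𝟙 Q?
𝟙-⇔ P⇔Q P? Q? = cong (if_then 1 else 0) (does-⇔ P⇔Q P? Q?)

𝟙-exclusive-+ : {P : Set p} {Q : Set q} {R R′ : Set r} → (P → ¬ Q) → R ⇔ R′ →
                (P? : Dec P) (Q? : Dec Q) (R? : Dec R) (R′? : Dec R′) →
                𝟙 (P? ×-dec R?) + 𝟙 (Q? ×-dec R′?) ≤ 𝟙 R?
𝟙-exclusive-+ P→¬Q R⇔R′ P? Q? R? R′? with P? | Q?
... | yes p | yes q = contradiction q (P→¬Q p)
... | yes _ | no _  = ≤-reflexive (+-identityʳ _)
... | no _  | yes _ = ≤-reflexive (sym (𝟙-⇔ R⇔R′ R? R′?))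
... | no _  | no _  = z≤n

𝟙-inside-or-outside : {L : Set p} {P : Set q} {Q : Set r} {E : Set s}
                      (L? : Dec L) (P? : Dec P) (Q? : Dec Q) (E? : Dec E) →
  𝟙 (L? ×-dec E?) ≤ 𝟙 (L? ×-dec P? ×-dec Q? ×-dec E?)
                      + (𝟙 (¬? P?) * 𝟙 (L? ×-dec E?) + 𝟙 (¬? Q?) * 𝟙 (L? ×-dec E?))
𝟙-inside-or-outside L? P? Q? E? with L? | E?
... | no _  | _     = z≤n
... | yes _ | no _  = z≤n
... | yes _ | yes _ with P? | Q?
...   | yes _ | yes _ = s≤s z≤n
...   | yes _ | no _  = s≤s z≤n
...   | no _  | _     = s≤s z≤n

∑-mono-≤ : {f g : Fin n → ℕ} → (∀ i → f i ≤ g i) → sum f ≤ sum g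
∑-mono-≤ {n = zero}  f≤g = z≤n
∑-mono-≤ {n = suc n} f≤g = +-mono-≤ (f≤g zero) (∑-mono-≤ (f≤g ∘ suc))

filter-filter : {P : Pred A p} {Q : Pred A q} (P? : U.Decidable P) (Q? : U.Decidable Q) (xs : List A) →
                filter P? (filter Q? xs) ≡ filter (Q? ∩? P?) xs
filter-filter P? Q? [] = refl
filter-filter P? Q? (x ∷ xs) with does (Q? x)
... | false = filter-filter P? Q? xs
... | true with does (P? x)
...   | false = filter-filter P? Q? xs
...   | true  = cong (x ∷_) (filter-filter P? Q? xs)

module _ {P : Pred A p} (P? : U.Decidable P) where

  length-filter-tabulate : (f : Fin n → A) → length (filter P? (tabulate f)) ≡ ∑[ i < n ] 𝟙 (P? (f i))
  length-filter-tabulate {n = zero}  f = refl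
  length-filter-tabulate {n = suc n} f with does (P? (f zero))
  ... | false = length-filter-tabulate (f ∘ suc)
  ... | true  = cong suc (length-filter-tabulate (f ∘ suc))

  length-filter-concatMap-tabulate : {B : Set a} (f : B → List A) (g : Fin n → B) →
    length (filter P? (concatMap f (tabulate g))) ≡ ∑[ i < n ] length (filter P? (f (g i)))
  length-filter-concatMap-tabulate {n = zero}  f g = refl
  length-filter-concatMap-tabulate {n = suc n} f g = begin
    length (filter P? (f (g zero) ++ concatMap f (tabulate (g ∘ suc))))
      ≡⟨ cong length (filter-++ P? (f (g zero)) _) ⟩
    length (filter P? (f (g zero)) ++ filter P? (concatMap f (tabulate (g ∘ suc))))
      ≡⟨ length-++ (filter P? (f (g zero))) ⟩
    length (filter P? (f (g zero))) + length (filter P? (concatMap f (tabulate (g ∘ suc))))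
      ≡⟨ cong (length (filter P? (f (g zero))) +_) (length-filter-concatMap-tabulate f (g ∘ suc)) ⟩
    ∑[ i < suc n ] length (filter P? (f (g i))) ∎
    where open ≡-Reasoning

length-filter-pairs : {P : Pred (Fin n × Fin n) p} (P? : U.Decidable P) →
  length (filter P? (pairs n)) ≡ ∑[ x < n ] ∑[ y < n ] 𝟙 (x <? y ×-dec P? (x , y))
length-filter-pairs {n} P? = begin
  length (filter P? (filter ordered? (concatMap row (tabulate id))))
    ≡⟨ cong length (filter-filter P? ordered? (concatMap row (tabulate id))) ⟩
  length (filter R? (concatMap row (tabulate id)))
    ≡⟨ length-filter-concatMap-tabulate R? row id ⟩
  ∑[ x < n ] length (filter R? (row x))
    ≡⟨ sum-cong-≗ (λ x → cong (length ∘ filter R?) (map-tabulate id (x ,_))) ⟩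
  ∑[ x < n ] length (filter R? (tabulate (x ,_)))
    ≡⟨ sum-cong-≗ (λ x → length-filter-tabulate R? (x ,_)) ⟩
  ∑[ x < n ] ∑[ y < n ] 𝟙 (x <? y ×-dec P? (x , y)) ∎
  where
  open ≡-Reasoning
  ordered? : U.Decidable (λ (p : Fin n × Fin n) → toℕ (proj₁ p) < toℕ (proj₂ p))
  ordered? (x , y) = x <? y
  R? = ordered? ∩? P?
  row : Fin n → List (Fin n × Fin n)
  row x = map (x ,_) (tabulate id)

∣tabulate∣≡∑𝟙 : (f : Fin n → Bool) → ∣ Vec.tabulate f ∣ ≡ ∑[ i < n ] 𝟙 (f i Bool.≟ true)
∣tabulate∣≡∑𝟙 {n = zero}  f = refl
∣tabulate∣≡∑𝟙 {n = suc n} f with f zero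
... | false = ∣tabulate∣≡∑𝟙 (f ∘ suc)
... | true  = cong suc (∣tabulate∣≡∑𝟙 (f ∘ suc))

∣∁p∣≡∑𝟙∉ : (p : Subset n) → ∣ ∁ p ∣ ≡ ∑[ i < n ] 𝟙 (¬? (i ∈? p))
∣∁p∣≡∑𝟙∉ Vec.[]          = refl
∣∁p∣≡∑𝟙∉ (true  Vec.∷ p) = ∣∁p∣≡∑𝟙∉ p
∣∁p∣≡∑𝟙∉ (false Vec.∷ p) = cong suc (∣∁p∣≡∑𝟙∉ p)

∑∑-distrib-+ : (f g : Fin n → Fin n → ℕ) →
  ∑[ x < n ] ∑[ y < n ] (f x y + g x y) ≡ ∑[ x < n ] ∑[ y < n ] f x y + ∑[ x < n ] ∑[ y < n ] g x y
∑∑-distrib-+ {n} f g = trans (sum-cong-≗ (λ x → ∑-distrib-+ (f x) (g x)))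
                             (∑-distrib-+ (λ x → ∑[ y < n ] f x y) (λ x → ∑[ y < n ] g x y))

∑∑-endpoint-weights : (c : Fin n → ℕ) (e : Fin n → Fin n → ℕ) →
  ∑[ x < n ] ∑[ y < n ] (c x * e x y + c y * e x y) ≡ ∑[ u < n ] (c u * (∑[ w < n ] e u w + ∑[ w < n ] e w u))
∑∑-endpoint-weights {n} c e = begin
  ∑[ x < n ] ∑[ y < n ] (c x * e x y + c y * e x y)
    ≡⟨ ∑∑-distrib-+ (λ x y → c x * e x y) (λ x y → c y * e x y) ⟩
  ∑[ x < n ] ∑[ y < n ] (c x * e x y) + ∑[ x < n ] ∑[ y < n ] (c y * e x y)
    ≡⟨ cong (∑[ x < n ] ∑[ y < n ] (c x * e x y) +_) (∑-comm (λ x y → c y * e x y)) ⟩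
  ∑[ u < n ] ∑[ w < n ] (c u * e u w) + ∑[ u < n ] ∑[ w < n ] (c u * e w u)
    ≡⟨ sym (∑-distrib-+ (λ u → ∑[ w < n ] (c u * e u w)) (λ u → ∑[ w < n ] (c u * e w u))) ⟩
  ∑[ u < n ] (∑[ w < n ] (c u * e u w) + ∑[ w < n ] (c u * e w u))
    ≡⟨ sum-cong-≗ (λ u → sym (cong₂ _+_ (*-distribˡ-sum (c u) (e u)) (*-distribˡ-sum (c u) (λ w → e w u)))) ⟩
  ∑[ u < n ] (c u * ∑[ w < n ] e u w + c u * ∑[ w < n ] e w u)
    ≡⟨ sum-cong-≗ (λ u → sym (*-distribˡ-+ (c u) (∑[ w < n ] e u w) (∑[ w < n ] e w u))) ⟩
  ∑[ u < n ] (c u * (∑[ w < n ] e u w + ∑[ w < n ] e w u)) ∎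
  where open ≡-Reasoning

module _ {ℓ} {_~_ : Rel (Fin n) ℓ} (_~?_ : Decidable _~_) where

  degree : Fin n → ℕ
  degree u = ∑[ w < n ] 𝟙 (u ~? w)

  ordered-degrees≤degree : Symmetric _~_ → (u : Fin n) →
    ∑[ w < n ] 𝟙 (u <? w ×-dec u ~? w) + ∑[ w < n ] 𝟙 (w <? u ×-dec w ~? u) ≤ degree u
  ordered-degrees≤degree ~-sym u =
    ≤-trans (≤-reflexive (sym (∑-distrib-+ (λ w → 𝟙 (u <? w ×-dec u ~? w)) (λ w → 𝟙 (w <? u ×-dec w ~? u)))))
            (∑-mono-≤ (λ w → 𝟙-exclusive-+ (<-asym {x = u} {w}) (mk⇔ ~-sym ~-sym) (u <? w) (w <? u) (u ~? w) (w ~? u)))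

  edges≤edgesInside+∑degreesOutside : Symmetric _~_ → (S : Subset n) →
    length (filter (uncurry _~?_) (pairs n))
      ≤ length (filter (λ p → proj₁ p ∈? S ×-dec proj₂ p ∈? S ×-dec proj₁ p ~? proj₂ p) (pairs n))
        + ∑[ u < n ] (𝟙 (¬? (u ∈? S)) * degree u)
  edges≤edgesInside+∑degreesOutside ~-sym S = begin
    length (filter (uncurry _~?_) (pairs n))
      ≡⟨ length-filter-pairs (uncurry _~?_) ⟩
    ∑[ x < n ] ∑[ y < n ] edge x y
      ≤⟨ ∑-mono-≤ (λ x → ∑-mono-≤ (λ y → 𝟙-inside-or-outside (x <? y) (x ∈? S) (y ∈? S) (x ~? y))) ⟩
    ∑[ x < n ] ∑[ y < n ] (edgeInside x y + (outside x * edge x y + outside y * edge x y))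
      ≡⟨ ∑∑-distrib-+ edgeInside (λ x y → outside x * edge x y + outside y * edge x y) ⟩
    ∑[ x < n ] ∑[ y < n ] edgeInside x y + ∑[ x < n ] ∑[ y < n ] (outside x * edge x y + outside y * edge x y)
      ≡⟨ cong₂ _+_ (sym (length-filter-pairs inside?)) (∑∑-endpoint-weights outside edge) ⟩
    length (filter inside? (pairs n)) + ∑[ u < n ] (outside u * (∑[ w < n ] edge u w + ∑[ w < n ] edge w u))
      ≤⟨ +-monoʳ-≤ _ (∑-mono-≤ (λ u → *-monoʳ-≤ (outside u) (ordered-degrees≤degree ~-sym u))) ⟩
    length (filter inside? (pairs n)) + ∑[ u < n ] (outside u * degree u) ∎
    where
    open ≤-Reasoning
    inside? : U.Decidable (λ (p : Fin n × Fin n) → proj₁ p ∈ S × proj₂ p ∈ S × proj₁ p ~ proj₂ p)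
    inside? p = proj₁ p ∈? S ×-dec proj₂ p ∈? S ×-dec proj₁ p ~? proj₂ p
    edge edgeInside : Fin n → Fin n → ℕ
    edge x y = 𝟙 (x <? y ×-dec x ~? y)
    edgeInside x y = 𝟙 (x <? y ×-dec inside? (x , y))
    outside : Fin n → ℕ
    outside u = 𝟙 (¬? (u ∈? S))

module _ (H : ThreeGraph n) where

  Edge-swap₁₂ : {a b c : Fin n} → Edge H a b c → Edge H b a c
  Edge-swap₁₂ {a} {b} {c} = trans (sym (sym₁₂ H a b c))

  Edge-swap₂₃ : {a b c : Fin n} → Edge H a b c → Edge H a c b
  Edge-swap₂₃ {a} {b} {c} = trans (sym (sym₂₃ H a b c))

  Edge-rotate : {a b c : Fin n} → Edge H a b c → Edge H b c a
  Edge-rotate = Edge-swap₂₃ ∘ Edge-swap₁₂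

  link? : (v : Fin n) → Decidable (Edge H v)
  link? v x y = E H v x y Bool.≟ true

  common-link-neighbours-nonadjacent : K4⁻-free H → F5-free H → {v u x y z : Fin n} →
    Edge H v u x → Edge H v u y → ¬ Edge H x y z
  common-link-neighbours-nonadjacent k4 f5 {v} {u} {x} {y} {z} vux vuy xyz
    with distinct H v u x vux | distinct H v u y vuy | distinct H x y z xyz | z ≟ᶠ v | z ≟ᶠ u
  ... | v≢u , u≢x , v≢x | _ , u≢y , v≢y | x≢y , _ , _ | yes refl | _ =
    k4 v u x y ((v≢u ∷ v≢x ∷ v≢y ∷ []) ∷ (u≢x ∷ u≢y ∷ []) ∷ (x≢y ∷ []) ∷ [] ∷ [])
       (vux , vuy , Edge-rotate (Edge-rotate xyz))
  ... | v≢u , u≢x , v≢x | _ , u≢y , v≢y | x≢y , _ , _ | no _ | yes refl =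
    k4 u v x y ((≢-sym v≢u ∷ u≢x ∷ u≢y ∷ []) ∷ (v≢x ∷ v≢y ∷ []) ∷ (x≢y ∷ []) ∷ [] ∷ [])
       (Edge-swap₁₂ vux , Edge-swap₁₂ vuy , Edge-rotate (Edge-rotate xyz))
  ... | v≢u , u≢x , v≢x | _ , u≢y , v≢y | x≢y , y≢z , x≢z | no z≢v | no z≢u =
    f5 v u x y z ((v≢u ∷ v≢x ∷ v≢y ∷ ≢-sym z≢v ∷ []) ∷ (u≢x ∷ u≢y ∷ ≢-sym z≢u ∷ []) ∷
                  (x≢y ∷ x≢z ∷ []) ∷ (y≢z ∷ []) ∷ [] ∷ [])
       (vux , vuy , xyz)

  linkNeighbourhood : Fin n → Fin n → Subset n
  linkNeighbourhood v u = Vec.tabulate (E H v u)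

  ∈-linkNeighbourhood : {v u w : Fin n} → w ∈ linkNeighbourhood v u → Edge H v u w
  ∈-linkNeighbourhood {v} {u} {w} w∈ = trans (sym (Vec.lookup∘tabulate (E H v u) w)) (Vec.[]=⇒lookup w∈)

  linkNeighbourhood-independent : K4⁻-free H → F5-free H → (v u : Fin n) →
    Independent H (linkNeighbourhood v u)
  linkNeighbourhood-independent k4 f5 v u a b c abc =
      (λ (a∈ , b∈) → nonadjacent (∈-linkNeighbourhood a∈) (∈-linkNeighbourhood b∈) abc)
    , (λ (a∈ , c∈) → nonadjacent (∈-linkNeighbourhood a∈) (∈-linkNeighbourhood c∈) (Edge-swap₂₃ abc))
    , (λ (b∈ , c∈) → nonadjacent (∈-linkNeighbourhood b∈) (∈-linkNeighbourhood c∈) (Edge-rotate abc))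
    where nonadjacent = common-link-neighbours-nonadjacent k4 f5

  linkDegree≤α : K4⁻-free H → F5-free H → {α : ℕ} → IsIndependenceNumber H α →
    (v u : Fin n) → degree (link? v) u ≤ α
  linkDegree≤α k4 f5 {α} (_ , maximal) v u =
    subst (_≤ α) (∣tabulate∣≡∑𝟙 (E H v u)) (maximal _ (linkNeighbourhood-independent k4 f5 v u))

lemma5p4 : ∀ {n : ℕ} (H : ThreeGraph n) → K4⁻-free H → F5-free H →
    ∀ (α : ℕ) → IsIndependenceNumber H α →
    ∀ (S : Subset n) (v : Fin n) →
    linkSize H v ≤ linkIn H v S + α * ∣ ∁ S ∣
lemma5p4 {n} H k4 f5 α isα S v = begin
  linkSize H v
    ≤⟨ edges≤edgesInside+∑degreesOutside (link? H v) (Edge-swap₂₃ H) S ⟩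
  linkIn H v S + ∑[ u < n ] (outside u * degree (link? H v) u)
    ≤⟨ +-monoʳ-≤ (linkIn H v S) (∑-mono-≤ (λ u → *-monoʳ-≤ (outside u) (linkDegree≤α H k4 f5 isα v u))) ⟩
  linkIn H v S + ∑[ u < n ] (outside u * α)
    ≡⟨ cong (linkIn H v S +_) (sym (*-distribʳ-sum α outside)) ⟩
  linkIn H v S + (∑[ u < n ] outside u) * α
    ≡⟨ cong (λ k → linkIn H v S + k * α) (sym (∣∁p∣≡∑𝟙∉ S)) ⟩
  linkIn H v S + ∣ ∁ S ∣ * α
    ≡⟨ cong (linkIn H v S +_) (*-comm ∣ ∁ S ∣ α) ⟩
  linkIn H v S + α * ∣ ∁ S ∣ ∎
  where
  open ≤-Reasoning
  outside : Fin n → ℕ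
  outside u = 𝟙 (¬? (u ∈? S))
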